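{- Let $n\geqslant1$, let $v$ be an odd positive divisor of $n$, and $l=n/v$. Let $H\subseteq\{1,\dots,v-1\}\subseteq\mathbb{Z}_n$ and $X\subseteq\mathbb{Z}_n$ satisfy: (i) $X=H+v\mathbb{Z}_n$; (ii) $X\uplus(-X)=\mathbb{Z}_n\setminus v\mathbb{Z}_n$ (i.e. $X\cup(-X)=\mathbb{Z}_n\setminus v\mathbb{Z}_n$ and $X\cap(-X)=\emptyset$). Then $Dih(n,X,X)$ is a DSRG with parameters $\left(2n,\,n-l,\,\frac{n-l}{2},\,\frac{n-l}{2}-l,\,\frac{n-l}{2}\right)$.
   Context: $D_n=\langle x,a\mid x^n=1,\ a^2=1,\ ax=x^{ -1}a\rangle$; $Dih(n,X,Y)$ is the Cayley digraph on $D_n$ with connection set $\{x^i:i\in X\}\cup\{x^ja:j\in Y\}$. A DSRG with parameters $(N,k,\mu,\lambda,t)$ is a digraph on $N$ vertices with adjacency matrix $A$ satisfying $AJ=JA=kJ$ and $A^2=tI+\lambda A+\mu(J-I-A)$. $v\mathbb{Z}_n$ is the subgroup of multiples of $v$; $H+v\mathbb{Z}_n=\{h+w:h\in H,w\in v\mathbb{Z}_n\}$; $\uplus$ is multiset union. -}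

module Defs where

open import Data.Nat using (ℕ; zero; suc; _+_; _*_; _∸_; NonZero)
open import Data.Nat.DivMod using (_mod_)
open import Data.Fin using (Fin; toℕ)
open import Data.Fin.Subset using (Subset)
open import Data.Bool using (Bool; true; false; if_then_else_; _xor_)
open import Data.Vec using (lookup)
open import Data.List using (List; []; _∷_; length; concatMap; map)
open import Data.Fin.Properties using (_≟_)
open import Data.Bool.Properties renaming (_≟_ to _≟B_)
open import Data.Product using (_×_; _,_; ∃; Σ)
open import Data.Integer using (ℤ; +_; _-_) renaming (_*_ to _*ℤ_; _+_ to _+ℤ_)
open import Data.List using (allFin) public
open import Relation.Nullary using (does)
open import Relation.Binary.PropositionalEquality using (_≡_)
open import Relation.Binary.Definitions using (DecidableEquality)

module _ (n : ℕ) .{{_ : NonZero n}} where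

  _⊕_ : Fin n → Fin n → Fin n
  i ⊕ j = (toℕ i + toℕ j) mod n

  ⊝_ : Fin n → Fin n
  ⊝ i = (n ∸ toℕ i) mod n

  InVZ : ℕ → Fin n → Set
  InVZ v i = ∃ λ (m : ℕ) → (v * m) mod n ≡ i

  -- The dihedral group D_n: the pair (i , e) stands for x^i a^e
  -- (e = false : a^0, e = true : a^1).

  Dn : Set
  Dn = Fin n × Bool

  -- (x^i a^e)(x^j a^f) = x^(i ± j) a^(e xor f), using a x = x^{-1} a
  dmul : Dn → Dn → Dn
  dmul (i , e) (j , f) = (i ⊕ (if e then ⊝ j else j)) , (e xor f)

  dinv : Dn → Dn
  dinv (i , false) = (⊝ i) , false
  dinv (i , true)  = i , true

  allDn : List Dn
  allDn = concatMap (λ i → (i , false) ∷ (i , true) ∷ []) (allFin n)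

  inConn : Subset n → Subset n → Dn → Bool
  inConn X Y (i , false) = lookup X i
  inConn X Y (j , true)  = lookup Y j

  Dih : Subset n → Subset n → Dn → Dn → Bool
  Dih X Y g h = inConn X Y (dmul (dinv g) h)

  _≟D_ : DecidableEquality Dn
  (i , e) ≟D (j , f) with i ≟ j | e ≟B f
  ... | Relation.Nullary.yes Relation.Binary.PropositionalEquality.refl
      | Relation.Nullary.yes Relation.Binary.PropositionalEquality.refl
      = Relation.Nullary.yes Relation.Binary.PropositionalEquality.refl
  ... | Relation.Nullary.no p | _ =
        Relation.Nullary.no λ { Relation.Binary.PropositionalEquality.refl → p Relation.Binary.PropositionalEquality.refl }
  ... | Relation.Nullary.yes _ | Relation.Nullary.no q =
        Relation.Nullary.no λ { Relation.Binary.PropositionalEquality.refl → q Relation.Binary.PropositionalEquality.refl }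

count : {V : Set} → List V → (V → Bool) → ℕ
count [] p = 0
count (x ∷ xs) p = if p x then suc (count xs p) else count xs p

b2ℤ : Bool → ℤ
b2ℤ true  = + 1
b2ℤ false = + 0

-- A digraph with vertex list vs (listing every vertex exactly once) and
-- 0/1 adjacency matrix A (A u w = 1 iff arc u → w) is a DSRG with
-- parameters (N, k, μ, λ, t) iff it has N vertices,
--   A J = k J  (every out-degree is k),  J A = k J  (every in-degree is k),
--   A² = t I + λ A + μ (J − I − A)   (checked entrywise, over ℤ).
IsDSRG : {V : Set} → DecidableEquality V → List V → (V → V → Bool) →
         ℕ → ℕ → ℤ → ℤ → ℤ → Set
IsDSRG {V} _≟V_ vs A N k μ λ' t =
    (length vs ≡ N)
  × ((u : V) → count vs (λ w → A u w) ≡ k)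
  × ((w : V) → count vs (λ u → A u w) ≡ k)
  × ((u w : V) →
       + count vs (λ z → A u z Data.Bool.∧ A z w)
       ≡ (t *ℤ I u w +ℤ λ' *ℤ b2ℤ (A u w))
         +ℤ μ *ℤ ((+ 1 - I u w) - b2ℤ (A u w)))
  where
    I : V → V → ℤ
    I u w = b2ℤ (does (u ≟V w))

module Submission where

-- Write the vertices as x^i a^f.  For u = x^i a^e the x-exponent of u⁻¹ x^j a^f is
-- o_u(j) = j − i (e = 0) or i − j (e = 1), independent of f; as both halves of the
-- connection set are X, u → x^j a^f is an arc iff o_u(j) ∈ X.  Each o_u is a
-- permutation of ℤ_n, so all in- and out-degrees are 2|X|.  On a 2-walk
-- u → x^j a^f → x^k a^g the second arc asks k − j ∈ X (f = 0) or j − k ∈ X (f = 1),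
-- and X ⊎ −X = ℤ_n ∖ vℤ_n makes exactly one of k − j ∈ X, j − k ∈ X, j ≡ k (mod v)
-- true.  Hence the 2-walks are counted by the j ≢ k (mod v) with o_u(j) ∈ X.  As X is
-- a union of cosets of vℤ_n, o_u(j) ∈ X is constant, equal to A(u, w), on the l
-- indices j ≡ k, so there are |X| − l·A(u, w) of them; summing the trichotomy over j
-- gives 2|X| + l = n.  With t = μ = |X| and λ = μ − l this is the DSRG equation.

open import Data.Nat.Base using (ℕ; NonZero)

module ModularCongruence where

  open import Data.Nat as ℕ using (_<_; _≤_)
  import Data.Nat.Properties as ℕ
  import Data.Nat.Divisibility as ℕ
  open import Data.Nat.DivMod using (_%_; _/_; m≡m%n+[m/n]*n; %-remove-+ˡ; m<n⇒m%n≡m)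
  open import Data.Integer using (ℤ; +_; _+_; _-_; -_; _*_)
  import Data.Integer.Properties as ℤ
  open import Data.Integer.Divisibility.Signed
    using (_∣_; divides; ∣-trans; ∣m∣n⇒∣m+n; ∣m⇒∣-m; ∣ᵤ⇒∣; ∣⇒∣ᵤ)
  open import Data.Integer.Tactic.RingSolver using (solve-∀)
  open import Data.Sum using (inj₁; inj₂)
  open import Relation.Binary.Bundles using (Setoid)
  import Relation.Binary.Reasoning.Setoid
  open import Relation.Binary.PropositionalEquality

  -- Written x ≈ y [mod d ]: without the space, d] would lex as one identifier.
  infix 4 _≈_[mod_]
  record _≈_[mod_] (x y : ℤ) (d : ℕ) : Set where
    constructor ∣-difference
    field divides-difference : + d ∣ x - y

  module _ {d : ℕ} where

    ≈[mod]-refl : ∀ {x} → x ≈ x [mod d ]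
    ≈[mod]-refl {x} = ∣-difference (divides (+ 0) (ℤ.+-inverseʳ x))

    ≈[mod]-reflexive : ∀ {x y} → x ≡ y → x ≈ y [mod d ]
    ≈[mod]-reflexive refl = ≈[mod]-refl

    ≈[mod]-sym : ∀ {x y} → x ≈ y [mod d ] → y ≈ x [mod d ]
    ≈[mod]-sym {x} {y} (∣-difference d∣x-y) =
      ∣-difference (subst (+ d ∣_) (swap x y) (∣m⇒∣-m d∣x-y))
      where
      swap : ∀ x y → - (x - y) ≡ y - x
      swap = solve-∀

    ≈[mod]-trans : ∀ {x y z} → x ≈ y [mod d ] → y ≈ z [mod d ] → x ≈ z [mod d ]
    ≈[mod]-trans {x} {y} {z} (∣-difference d∣x-y) (∣-difference d∣y-z) =
      ∣-difference (subst (+ d ∣_) (telescope x y z) (∣m∣n⇒∣m+n d∣x-y d∣y-z))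
      where
      telescope : ∀ x y z → (x - y) + (y - z) ≡ x - z
      telescope = solve-∀

    +-cong-[mod] : ∀ {x x′ y y′} → x ≈ x′ [mod d ] → y ≈ y′ [mod d ] → x + y ≈ x′ + y′ [mod d ]
    +-cong-[mod] {x} {x′} {y} {y′} (∣-difference d∣x-x′) (∣-difference d∣y-y′) =
      ∣-difference (subst (+ d ∣_) (regroup x x′ y y′) (∣m∣n⇒∣m+n d∣x-x′ d∣y-y′))
      where
      regroup : ∀ x x′ y y′ → (x - x′) + (y - y′) ≡ (x + y) - (x′ + y′)
      regroup = solve-∀

    neg-cong-[mod] : ∀ {x y} → x ≈ y [mod d ] → - x ≈ - y [mod d ]
    neg-cong-[mod] {x} {y} (∣-difference d∣x-y) =
      ∣-difference (subst (+ d ∣_) (neg-minus x y) (∣m⇒∣-m d∣x-y))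
      where
      neg-minus : ∀ x y → - (x - y) ≡ - x - - y
      neg-minus = solve-∀

    ≈[mod]-setoid : Setoid _ _
    ≈[mod]-setoid = record
      { Carrier = ℤ
      ; _≈_ = λ x y → x ≈ y [mod d ]
      ; isEquivalence = record { refl = ≈[mod]-refl ; sym = ≈[mod]-sym ; trans = ≈[mod]-trans }
      }

  module ≈[mod]-Reasoning (d : ℕ) = Relation.Binary.Reasoning.Setoid (≈[mod]-setoid {d})

  ≈[mod]-weaken : ∀ {m d x y} → m ℕ.∣ d → x ≈ y [mod d ] → x ≈ y [mod m ]
  ≈[mod]-weaken m∣d (∣-difference d∣x-y) = ∣-difference (∣-trans (∣ᵤ⇒∣ m∣d) d∣x-y)

  +*-≈[mod] : ∀ x q d → x + q * + d ≈ x [mod d ]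
  +*-≈[mod] x q d = ∣-difference (divides q (cancel x (q * + d)))
    where
    cancel : ∀ x y → (x + y) - x ≡ y
    cancel = solve-∀

  x+y≡d⇒x≈-y : ∀ {x y d} → x + y ≡ + d → x ≈ - y [mod d ]
  x+y≡d⇒x≈-y {x} {y} {d} x+y≡d = ∣-difference (divides (+ 1) (begin
    x - - y      ≡⟨ minus-neg x y ⟩
    x + y        ≡⟨ x+y≡d ⟩
    + d          ≡⟨ ℤ.*-identityˡ (+ d) ⟨
    + 1 * + d    ∎))
    where
    open ≡-Reasoning
    minus-neg : ∀ x y → x - - y ≡ x + y
    minus-neg = solve-∀

  %-≈[mod] : ∀ a d .{{_ : NonZero d}} → + (a % d) ≈ + a [mod d ]
  %-≈[mod] a d =
    ≈[mod]-sym (subst (_≈ + (a % d) [mod d ]) (sym a≡) (+*-≈[mod] (+ (a % d)) (+ (a / d)) d))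
    where
    a≡ : + a ≡ + (a % d) + + (a / d) * + d
    a≡ = begin
      + a                           ≡⟨ cong +_ (m≡m%n+[m/n]*n a d) ⟩
      + (a % d ℕ.+ a / d ℕ.* d)     ≡⟨ ℤ.pos-+ (a % d) _ ⟩
      + (a % d) + + (a / d ℕ.* d)   ≡⟨ cong (_+_ (+ (a % d))) (ℤ.pos-* (a / d) d) ⟩
      + (a % d) + + (a / d) * + d   ∎
      where open ≡-Reasoning

  ∣∸⇒%≡ : ∀ {a b d} .{{_ : NonZero d}} → b ≤ a → d ℕ.∣ a ℕ.∸ b → a % d ≡ b % d
  ∣∸⇒%≡ {a} {b} {d} b≤a d∣a∸b = begin
    a % d                   ≡⟨ cong (_% d) (ℕ.m∸n+n≡m b≤a) ⟨
    (a ℕ.∸ b ℕ.+ b) % d     ≡⟨ %-remove-+ˡ b d∣a∸b ⟩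
    b % d                   ∎
    where open ≡-Reasoning

  ≈[mod]⇒∣∸ : ∀ {a b d} → b ≤ a → + a ≈ + b [mod d ] → d ℕ.∣ a ℕ.∸ b
  ≈[mod]⇒∣∸ {a} {b} b≤a (∣-difference a≈b) =
    ∣⇒∣ᵤ (subst (_ ∣_) (trans (ℤ.m-n≡m⊖n a b) (ℤ.≤-⊖ b≤a)) a≈b)

  ≈[mod]⇒%≡ : ∀ {a b d} .{{_ : NonZero d}} → + a ≈ + b [mod d ] → a % d ≡ b % d
  ≈[mod]⇒%≡ {a} {b} a≈b with ℕ.≤-total b a
  ... | inj₁ b≤a = ∣∸⇒%≡ b≤a (≈[mod]⇒∣∸ b≤a a≈b)
  ... | inj₂ a≤b = sym (∣∸⇒%≡ a≤b (≈[mod]⇒∣∸ a≤b (≈[mod]-sym a≈b)))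

  %≡⇒≈[mod] : ∀ {a b d} .{{_ : NonZero d}} → a % d ≡ b % d → + a ≈ + b [mod d ]
  %≡⇒≈[mod] {a} {b} {d} eq =
    ≈[mod]-trans (≈[mod]-sym (%-≈[mod] a d))
      (≈[mod]-trans (≈[mod]-reflexive (cong +_ eq)) (%-≈[mod] b d))

  ≈[mod]-injective : ∀ {r s d} .{{_ : NonZero d}} → r < d → s < d → + r ≈ + s [mod d ] → r ≡ s
  ≈[mod]-injective {r} {s} {d} r<d s<d r≈s =
    trans (sym (m<n⇒m%n≡m r<d)) (trans (≈[mod]⇒%≡ r≈s) (m<n⇒m%n≡m s<d))

  ∣⇒≈[mod]0 : ∀ {a d} → d ℕ.∣ a → + a ≈ + 0 [mod d ]
  ∣⇒≈[mod]0 {a} d∣a = ∣-difference (∣ᵤ⇒∣ (subst (_ ℕ.∣_) (sym (ℕ.+-identityʳ a)) d∣a))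

  ≈[mod]0⇒∣ : ∀ {a d} → + a ≈ + 0 [mod d ] → d ℕ.∣ a
  ≈[mod]0⇒∣ = ≈[mod]⇒∣∸ ℕ.z≤n

  ≈[mod]⇒-≈0 : ∀ {x y d} → x ≈ y [mod d ] → x - y ≈ + 0 [mod d ]
  ≈[mod]⇒-≈0 {x} {y} (∣-difference d∣x-y) =
    ∣-difference (subst (_ ∣_) (sym (ℤ.+-identityʳ (x - y))) d∣x-y)

  -≈0⇒≈[mod] : ∀ {x y d} → x - y ≈ + 0 [mod d ] → x ≈ y [mod d ]
  -≈0⇒≈[mod] {x} {y} (∣-difference d∣x-y-0) =
    ∣-difference (subst (_ ∣_) (ℤ.+-identityʳ (x - y)) d∣x-y-0)

module Counting where

  open import Data.Nat as ℕ using (zero; suc; _+_; _*_; _<_; _≡ᵇ_; s<s)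
  import Data.Nat.Properties as ℕ
  import Data.Nat.Divisibility as ℕ
  open import Data.Nat.DivMod using (_%_; m<n⇒m%n≡m; %-remove-+ˡ)
  open import Data.Bool using (Bool; true; false; _∧_)
  open import Data.Bool.Properties using (∧-zeroʳ)
  open import Data.Fin using (Fin; zero; suc; toℕ)
  open import Data.Fin.Permutation using (permutation)
  open import Data.List using (List; []; _∷_; length; tabulate; allFin; concatMap)
  open import Data.Product using (_×_; _,_; proj₁; proj₂)
  open import Data.Sum using (_⊎_; inj₁; inj₂)
  open import Relation.Nullary using (¬_; contradiction)
  open import Data.Nat.Tactic.RingSolver using (solve-∀)
  open import Function using (_∘_; id)
  open import Algebra.Properties.CommutativeMonoid.Sum ℕ.+-0-commutativeMonoid
    using (sum; sum-cong-≗; sum-permute; ∑-distrib-+; sum-replicate-zero)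
  open import Relation.Binary.PropositionalEquality
  open import Defs using (count; allDn; Dn)

  fromBool : Bool → ℕ
  fromBool true  = 1
  fromBool false = 0

  infix 10 #_
  #_ : ∀ {n} → (Fin n → Bool) → ℕ
  # p = sum (fromBool ∘ p)

  #-cong : ∀ {n} {p q : Fin n → Bool} → (∀ j → p j ≡ q j) → # p ≡ # q
  #-cong p≗q = sum-cong-≗ (cong fromBool ∘ p≗q)

  #-∘-bijection : ∀ {n} (p : Fin n → Bool) (f g : Fin n → Fin n) →
                  (∀ y → f (g y) ≡ y) → (∀ x → g (f x) ≡ x) → # (p ∘ f) ≡ # p
  #-∘-bijection p f g f∘g g∘f = sym (sum-permute (fromBool ∘ p) (permutation f g f∘g g∘f))

  #-partition : ∀ {n} (p q r s : Fin n → Bool) →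
                (∀ j → fromBool (p j) + fromBool (q j) + fromBool (r j) ≡ fromBool (s j)) →
                # p + # q + # r ≡ # s
  #-partition p q r s split = begin
    # p + # q + # r                     ≡⟨ cong (_+ # r) (∑-distrib-+ (fromBool ∘ p) (fromBool ∘ q)) ⟨
    sum p+q + # r                       ≡⟨ ∑-distrib-+ p+q (fromBool ∘ r) ⟨
    sum (λ j → p+q j + fromBool (r j))  ≡⟨ sum-cong-≗ split ⟩
    # s                                 ∎
    where
    open ≡-Reasoning
    p+q : Fin _ → ℕ
    p+q j = fromBool (p j) + fromBool (q j)

  #-true : ∀ n → # (λ (_ : Fin n) → true) ≡ n
  #-true zero    = refl
  #-true (suc n) = cong suc (#-true n)

  #-const-∧ : ∀ {n} c (q : Fin n → Bool) → # (λ j → c ∧ q j) ≡ fromBool c * # q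
  #-const-∧ {n} false q = sum-replicate-zero n
  #-const-∧ true  q = sym (ℕ.+-identityʳ (# q))

  count-∷ : ∀ {V : Set} (x : V) xs p → count (x ∷ xs) p ≡ fromBool (p x) + count xs p
  count-∷ x xs p with p x
  ... | true  = refl
  ... | false = refl

  count-tabulate : ∀ {V : Set} {n} (f : Fin n → V) p → count (tabulate f) p ≡ # (p ∘ f)
  count-tabulate {n = zero}  f p = refl
  count-tabulate {n = suc n} f p =
    trans (count-∷ (f zero) (tabulate (f ∘ suc)) p)
          (cong (fromBool (p (f zero)) +_) (count-tabulate (f ∘ suc) p))

  count-const-true : ∀ {V : Set} (xs : List V) → count xs (λ _ → true) ≡ length xs
  count-const-true []       = refl
  count-const-true (x ∷ xs) = cong suc (count-const-true xs)

  count-concatMap-pairs : ∀ {A : Set} (xs : List A) (p : A × Bool → Bool) →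
    count (concatMap (λ i → (i , false) ∷ (i , true) ∷ []) xs) p
      ≡ count xs (λ i → p (i , false)) + count xs (λ i → p (i , true))
  count-concatMap-pairs []       p = refl
  count-concatMap-pairs (x ∷ xs) p = begin
    count ((x , false) ∷ (x , true) ∷ rest) p       ≡⟨ count-∷ (x , false) ((x , true) ∷ rest) p ⟩
    a + count ((x , true) ∷ rest) p                  ≡⟨ cong (a +_) (count-∷ (x , true) rest p) ⟩
    a + (b + count rest p)                           ≡⟨ cong (λ m → a + (b + m)) (count-concatMap-pairs xs p) ⟩
    a + (b + (count xs p₀ + count xs p₁))            ≡⟨ interleave a b (count xs p₀) (count xs p₁) ⟩
    (a + count xs p₀) + (b + count xs p₁)            ≡⟨ cong₂ _+_ (count-∷ x xs p₀) (count-∷ x xs p₁) ⟨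
    count (x ∷ xs) p₀ + count (x ∷ xs) p₁            ∎
    where
    open ≡-Reasoning
    rest = concatMap (λ i → (i , false) ∷ (i , true) ∷ []) xs
    p₀ p₁ : _ → Bool
    p₀ i = p (i , false)
    p₁ i = p (i , true)
    a = fromBool (p₀ x)
    b = fromBool (p₁ x)
    interleave : ∀ a b c d → a + (b + (c + d)) ≡ (a + c) + (b + d)
    interleave = solve-∀

  count-allDn : ∀ n .{{_ : ℕ.NonZero n}} (p : Dn n → Bool) →
                count (allDn n) p ≡ # (λ j → p (j , false)) + # (λ j → p (j , true))
  count-allDn n p = trans (count-concatMap-pairs (allFin n) p)
    (cong₂ _+_ (count-tabulate id (λ i → p (i , false))) (count-tabulate id (λ i → p (i , true))))

  length-allDn : ∀ n .{{_ : ℕ.NonZero n}} → length (allDn n) ≡ 2 * n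
  length-allDn n = begin
    length (allDn n)                  ≡⟨ count-const-true (allDn n) ⟨
    count (allDn n) (λ _ → true)      ≡⟨ count-allDn n (λ _ → true) ⟩
    # all + # all                     ≡⟨ cong₂ _+_ (#-true n) (trans (#-true n) (sym (ℕ.+-identityʳ n))) ⟩
    n + (n + 0)                       ∎
    where
    open ≡-Reasoning
    all : Fin n → Bool
    all _ = true

  countBelow : ℕ → (ℕ → Bool) → ℕ
  countBelow zero    g = 0
  countBelow (suc k) g = fromBool (g 0) + countBelow k (g ∘ suc)

  #-toℕ : ∀ {n} (g : ℕ → Bool) → # (g ∘ toℕ {n}) ≡ countBelow n g
  #-toℕ {zero}  g = refl
  #-toℕ {suc n} g = cong (fromBool (g 0) +_) (#-toℕ {n} (g ∘ suc))

  countBelow-cong : ∀ k {g h : ℕ → Bool} → (∀ m → m < k → g m ≡ h m) → countBelow k g ≡ countBelow k h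
  countBelow-cong zero    g≗h = refl
  countBelow-cong (suc k) g≗h =
    cong₂ _+_ (cong fromBool (g≗h 0 ℕ.z<s)) (countBelow-cong k (λ m m<k → g≗h (suc m) (s<s m<k)))

  countBelow-+ : ∀ a b g → countBelow (a + b) g ≡ countBelow a g + countBelow b (g ∘ (a +_))
  countBelow-+ zero    b g = refl
  countBelow-+ (suc a) b g =
    trans (cong (fromBool (g 0) +_) (countBelow-+ a b (g ∘ suc))) (sym (ℕ.+-assoc (fromBool (g 0)) _ _))

  countBelow-false : ∀ k → countBelow k (λ _ → false) ≡ 0
  countBelow-false zero    = refl
  countBelow-false (suc k) = countBelow-false k

  countBelow-≡ᵇ : ∀ {k r} → r < k → countBelow k (_≡ᵇ r) ≡ 1
  countBelow-≡ᵇ {suc k} {zero}  _         = cong suc (countBelow-false k)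
  countBelow-≡ᵇ {suc k} {suc r} (s<s r<k) = countBelow-≡ᵇ r<k

  countBelow-residue : ∀ l v {r} .{{_ : ℕ.NonZero v}} → r < v → countBelow (l * v) (λ m → m % v ≡ᵇ r) ≡ l
  countBelow-residue zero    v r<v = refl
  countBelow-residue (suc l) v {r} r<v = begin
    countBelow (v + l * v) residue                                     ≡⟨ countBelow-+ v (l * v) residue ⟩
    countBelow v residue + countBelow (l * v) (residue ∘ (v +_))       ≡⟨ cong₂ _+_ first-block later-blocks ⟩
    1 + l                                                              ∎
    where
    open ≡-Reasoning
    residue : ℕ → Bool
    residue m = m % v ≡ᵇ r
    first-block : countBelow v residue ≡ 1
    first-block = trans (countBelow-cong v (λ m m<v → cong (_≡ᵇ r) (m<n⇒m%n≡m m<v))) (countBelow-≡ᵇ r<v)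
    later-blocks : countBelow (l * v) (residue ∘ (v +_)) ≡ l
    later-blocks = trans (countBelow-cong (l * v) (λ m _ → cong (_≡ᵇ r) (%-remove-+ˡ m ℕ.∣-refl)))
                         (countBelow-residue l v r<v)

  #-residue : ∀ {n} l v {r} .{{_ : ℕ.NonZero v}} → n ≡ l * v → r < v →
              # (λ (j : Fin n) → toℕ j % v ≡ᵇ r) ≡ l
  #-residue l v {r} refl r<v =
    trans (#-toℕ {l * v} (λ m → m % v ≡ᵇ r)) (countBelow-residue l v r<v)

  exactly-one : ∀ p q s → (s ≡ true → p ≡ false × q ≡ false) → (s ≡ false → p ≡ true ⊎ q ≡ true) →
                ¬ (p ≡ true × q ≡ true) → fromBool p + fromBool q + fromBool s ≡ 1
  exactly-one true  true  _     _       _       not-both = contradiction (refl , refl) not-both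
  exactly-one true  false true  s⇒none _       _        = contradiction (proj₁ (s⇒none refl)) λ ()
  exactly-one false true  true  s⇒none _       _        = contradiction (proj₂ (s⇒none refl)) λ ()
  exactly-one false false false _       ¬s⇒some _        with ¬s⇒some refl
  ... | inj₁ ()
  ... | inj₂ ()
  exactly-one true  false false _       _       _        = refl
  exactly-one false true  false _       _       _        = refl
  exactly-one false false true  _       _       _        = refl

  ∧-exactly-one : ∀ p q₁ q₂ s → fromBool q₁ + fromBool q₂ + fromBool s ≡ 1 →
                  fromBool (p ∧ q₁) + fromBool (p ∧ q₂) + fromBool (p ∧ s) ≡ fromBool p
  ∧-exactly-one false _ _ _ _   = refl
  ∧-exactly-one true  _ _ _ one = one

  ∧-cong-when : ∀ {p c} s → (s ≡ true → p ≡ c) → p ∧ s ≡ c ∧ s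
  ∧-cong-when {p} {c} true  p≡c = cong (_∧ true) (p≡c refl)
  ∧-cong-when {p} {c} false _   = trans (∧-zeroʳ p) (sym (∧-zeroʳ c))

  #-∧-split : ∀ {n} (p q₁ q₂ s : Fin n → Bool) c →
              (∀ j → fromBool (q₁ j) + fromBool (q₂ j) + fromBool (s j) ≡ 1) →
              (∀ j → s j ≡ true → p j ≡ c) →
              # (λ j → p j ∧ q₁ j) + # (λ j → p j ∧ q₂ j) + fromBool c * # s ≡ # p
  #-∧-split p q₁ q₂ s c one p≡c-on-s = begin
    rest + fromBool c * # s            ≡⟨ cong (rest +_) (#-const-∧ c s) ⟨
    rest + # (λ j → c ∧ s j)           ≡⟨ cong (rest +_) (#-cong λ j → ∧-cong-when (s j) (p≡c-on-s j)) ⟨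
    rest + # (λ j → p j ∧ s j)         ≡⟨ #-partition _ _ _ p split ⟩
    # p                                ∎
    where
    open ≡-Reasoning
    rest : ℕ
    rest = # (λ j → p j ∧ q₁ j) + # (λ j → p j ∧ q₂ j)
    split : ∀ j → fromBool (p j ∧ q₁ j) + fromBool (p j ∧ q₂ j) + fromBool (p j ∧ s j) ≡ fromBool (p j)
    split j = ∧-exactly-one (p j) (q₁ j) (q₂ j) (s j) (one j)

module CyclicGroup (n : ℕ) .{{_ : NonZero n}} where

  open import Data.Nat as ℕ using (_∸_)
  import Data.Nat.Properties as ℕ
  import Data.Nat.Divisibility as ℕ
  open import Data.Nat.DivMod using (_mod_; _%_; _/_; m%n<n; m<n⇒m%n≡m; m*[n/m]≡n)
  open import Data.Fin using (Fin; toℕ)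
  open import Data.Product using (_,_)
  open import Function using (_⇔_; mk⇔)
  open import Data.Fin.Properties using (toℕ-fromℕ<; toℕ-injective; toℕ<n)
  open import Data.Integer using (ℤ; +_; _+_; _-_; -_; _*_)
  import Data.Integer.Properties as ℤ
  open import Data.Integer.Tactic.RingSolver using (solve-∀)
  open import Relation.Binary.PropositionalEquality
  open import Data.Bool using (Bool)
  import Defs
  open ModularCongruence
  open Counting using (#_; #-∘-bijection)

  infixl 6 _⊕_
  infix 8 ⊝_

  _⊕_ : Fin n → Fin n → Fin n
  _⊕_ = Defs._⊕_ n

  ⊝_ : Fin n → Fin n
  ⊝_ = Defs.⊝_ n

  toℤ : Fin n → ℤ
  toℤ a = + toℕ a

  toℤ-mod : ∀ m → toℤ (m mod n) ≈ + m [mod n ]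
  toℤ-mod m = subst (_≈ + m [mod n ]) (cong +_ (sym (toℕ-fromℕ< (m%n<n m n)))) (%-≈[mod] m n)

  toℤ-⊕ : ∀ a b → toℤ (a ⊕ b) ≈ toℤ a + toℤ b [mod n ]
  toℤ-⊕ a b = ≈[mod]-trans (toℤ-mod (toℕ a ℕ.+ toℕ b)) (≈[mod]-reflexive (ℤ.pos-+ (toℕ a) (toℕ b)))

  toℤ-⊝ : ∀ a → toℤ (⊝ a) ≈ - toℤ a [mod n ]
  toℤ-⊝ a = ≈[mod]-trans (toℤ-mod (n ∸ toℕ a)) (x+y≡d⇒x≈-y
    (trans (sym (ℤ.pos-+ (n ∸ toℕ a) (toℕ a))) (cong +_ (ℕ.m∸n+n≡m (ℕ.<⇒≤ (toℕ<n a))))))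

  toℤ-injective : ∀ {a b} → toℤ a ≈ toℤ b [mod n ] → a ≡ b
  toℤ-injective {a} {b} a≈b = toℕ-injective (≈[mod]-injective (toℕ<n a) (toℕ<n b) a≈b)

  -- Identities in ℤ_n are proved by reflection: toℤ turns ⊕ and ⊝ into + and -
  -- modulo n and is injective on representatives, so an identity between terms
  -- follows from the ring identity between their images in ℤ.
  infixl 6 _⊞_
  infix 8 ⊟_

  data Term : Set where
    var : Fin n → Term
    _⊞_ : Term → Term → Term
    ⊟_  : Term → Term

  ⟦_⟧ : Term → Fin n
  ⟦ var a ⟧ = a
  ⟦ s ⊞ t ⟧ = ⟦ s ⟧ ⊕ ⟦ t ⟧
  ⟦ ⊟ t ⟧   = ⊝ ⟦ t ⟧

  ⟦_⟧ℤ : Term → ℤ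
  ⟦ var a ⟧ℤ = toℤ a
  ⟦ s ⊞ t ⟧ℤ = ⟦ s ⟧ℤ + ⟦ t ⟧ℤ
  ⟦ ⊟ t ⟧ℤ   = - ⟦ t ⟧ℤ

  ⟦⟧-sound : ∀ t → toℤ ⟦ t ⟧ ≈ ⟦ t ⟧ℤ [mod n ]
  ⟦⟧-sound (var a) = ≈[mod]-refl
  ⟦⟧-sound (s ⊞ t) = ≈[mod]-trans (toℤ-⊕ ⟦ s ⟧ ⟦ t ⟧) (+-cong-[mod] (⟦⟧-sound s) (⟦⟧-sound t))
  ⟦⟧-sound (⊟ t)   = ≈[mod]-trans (toℤ-⊝ ⟦ t ⟧) (neg-cong-[mod] (⟦⟧-sound t))

  ≡-byℤ : ∀ s t → ⟦ s ⟧ℤ ≡ ⟦ t ⟧ℤ → ⟦ s ⟧ ≡ ⟦ t ⟧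
  ≡-byℤ s t eq = toℤ-injective
    (≈[mod]-trans (⟦⟧-sound s) (≈[mod]-trans (≈[mod]-reflexive eq) (≈[mod]-sym (⟦⟧-sound t))))

  ⊕-comm : ∀ a b → a ⊕ b ≡ b ⊕ a
  ⊕-comm a b = cong (_mod n) (ℕ.+-comm (toℕ a) (toℕ b))

  ⊕-cancelˡ : ∀ c y → c ⊕ (⊝ c ⊕ y) ≡ y
  ⊕-cancelˡ c y = ≡-byℤ (var c ⊞ (⊟ var c ⊞ var y)) (var y) (cancel (toℤ c) (toℤ y))
    where
    cancel : ∀ c y → c + (- c + y) ≡ y
    cancel = solve-∀

  ⊝-cancelˡ : ∀ c y → ⊝ c ⊕ (c ⊕ y) ≡ y
  ⊝-cancelˡ c y = ≡-byℤ (⊟ var c ⊞ (var c ⊞ var y)) (var y) (cancel (toℤ c) (toℤ y))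
    where
    cancel : ∀ c y → - c + (c + y) ≡ y
    cancel = solve-∀

  reflect-involutive : ∀ c y → c ⊕ ⊝ (c ⊕ ⊝ y) ≡ y
  reflect-involutive c y = ≡-byℤ (var c ⊞ ⊟ (var c ⊞ ⊟ var y)) (var y) (cancel (toℤ c) (toℤ y))
    where
    cancel : ∀ c y → c + - (c + - y) ≡ y
    cancel = solve-∀

  ⊝-⊕-⊝ : ∀ j k → ⊝ (j ⊕ ⊝ k) ≡ ⊝ j ⊕ k
  ⊝-⊕-⊝ j k = ≡-byℤ (⊟ (var j ⊞ ⊟ var k)) (⊟ var j ⊞ var k) (neg-minus (toℤ j) (toℤ k))
    where
    neg-minus : ∀ j k → - (j + - k) ≡ - j + k
    neg-minus = solve-∀

  ⊕-assoc : ∀ a b c → (a ⊕ b) ⊕ c ≡ a ⊕ (b ⊕ c)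
  ⊕-assoc a b c =
    ≡-byℤ ((var a ⊞ var b) ⊞ var c) (var a ⊞ (var b ⊞ var c)) (ℤ.+-assoc (toℤ a) (toℤ b) (toℤ c))

  #-translate : ∀ c (p : Fin n → Bool) → # (λ j → p (c ⊕ j)) ≡ # p
  #-translate c p = #-∘-bijection p (c ⊕_) (⊝ c ⊕_) (⊕-cancelˡ c) (⊝-cancelˡ c)

  #-reflect : ∀ c (p : Fin n → Bool) → # (λ j → p (c ⊕ ⊝ j)) ≡ # p
  #-reflect c p =
    #-∘-bijection p (λ j → c ⊕ ⊝ j) (λ j → c ⊕ ⊝ j) (reflect-involutive c) (reflect-involutive c)

  module _ {m : ℕ} .{{_ : NonZero m}} (m∣n : m ℕ.∣ n) where

    ⟦⟧-sound-∣ : ∀ t → toℤ ⟦ t ⟧ ≈ ⟦ t ⟧ℤ [mod m ]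
    ⟦⟧-sound-∣ t = ≈[mod]-weaken m∣n (⟦⟧-sound t)

    InVZ⇔∣ : ∀ a → Defs.InVZ n m a ⇔ m ℕ.∣ toℕ a
    InVZ⇔∣ a = mk⇔ multiple⇒∣ ∣⇒multiple
      where
      multiple⇒∣ : Defs.InVZ n m a → m ℕ.∣ toℕ a
      multiple⇒∣ (q , refl) =
        subst (m ℕ.∣_) (sym (toℕ-fromℕ< (m%n<n (m ℕ.* q) n))) (ℕ.%-presˡ-∣ (ℕ.m∣m*n q) m∣n)
      ∣⇒multiple : m ℕ.∣ toℕ a → Defs.InVZ n m a
      ∣⇒multiple m∣a = toℕ a / m , toℕ-injective (begin
        toℕ ((m ℕ.* (toℕ a / m)) mod n)   ≡⟨ toℕ-fromℕ< (m%n<n _ n) ⟩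
        m ℕ.* (toℕ a / m) % n             ≡⟨ cong (_% n) (m*[n/m]≡n m∣a) ⟩
        toℕ a % n                         ≡⟨ m<n⇒m%n≡m (toℕ<n a) ⟩
        toℕ a                             ∎)
        where open ≡-Reasoning

    ∣-⊕ : ∀ {a b} → m ℕ.∣ toℕ a → m ℕ.∣ toℕ b → m ℕ.∣ toℕ (a ⊕ b)
    ∣-⊕ {a} {b} m∣a m∣b = subst (m ℕ.∣_) (sym (toℕ-fromℕ< (m%n<n (toℕ a ℕ.+ toℕ b) n)))
      (ℕ.%-presˡ-∣ (ℕ.∣m∣n⇒∣m+n m∣a m∣b) m∣n)

    ∣⊕⊝⇔%≡ : ∀ j k → m ℕ.∣ toℕ (j ⊕ ⊝ k) ⇔ toℕ j % m ≡ toℕ k % m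
    ∣⊕⊝⇔%≡ j k = mk⇔
      (λ m∣ → ≈[mod]⇒%≡ (-≈0⇒≈[mod] (begin
        toℤ j - toℤ k    ≈⟨ ⟦⟧-sound-∣ (var j ⊞ ⊟ var k) ⟨
        toℤ (j ⊕ ⊝ k)    ≈⟨ ∣⇒≈[mod]0 m∣ ⟩
        + 0              ∎)))
      (λ j≡k → ≈[mod]0⇒∣ (begin
        toℤ (j ⊕ ⊝ k)    ≈⟨ ⟦⟧-sound-∣ (var j ⊞ ⊟ var k) ⟩
        toℤ j - toℤ k    ≈⟨ ≈[mod]⇒-≈0 (%≡⇒≈[mod] j≡k) ⟩
        + 0              ∎))
      where open ≈[mod]-Reasoning m

    %≡-⊕ : ∀ c {j k} → toℕ j % m ≡ toℕ k % m → toℕ (c ⊕ j) % m ≡ toℕ (c ⊕ k) % m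
    %≡-⊕ c {j} {k} j≡k = ≈[mod]⇒%≡ (begin
      toℤ (c ⊕ j)      ≈⟨ ⟦⟧-sound-∣ (var c ⊞ var j) ⟩
      toℤ c + toℤ j    ≈⟨ +-cong-[mod] (≈[mod]-refl {x = toℤ c}) (%≡⇒≈[mod] j≡k) ⟩
      toℤ c + toℤ k    ≈⟨ ⟦⟧-sound-∣ (var c ⊞ var k) ⟨
      toℤ (c ⊕ k)      ∎)
      where open ≈[mod]-Reasoning m

    %≡-⊝ : ∀ {j k} → toℕ j % m ≡ toℕ k % m → toℕ (⊝ j) % m ≡ toℕ (⊝ k) % m
    %≡-⊝ {j} {k} j≡k = ≈[mod]⇒%≡ (begin
      toℤ (⊝ j)        ≈⟨ ⟦⟧-sound-∣ (⊟ var j) ⟩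
      - toℤ j          ≈⟨ neg-cong-[mod] (%≡⇒≈[mod] j≡k) ⟩
      - toℤ k          ≈⟨ ⟦⟧-sound-∣ (⊟ var k) ⟨
      toℤ (⊝ k)        ∎)
      where open ≈[mod]-Reasoning m

module DSRGEquation where

  open import Data.Nat as ℕ using ()
  open import Data.Bool using (true; false)
  open import Data.Integer using (ℤ; +_; _+_; _-_; _*_)
  import Data.Integer.Properties as ℤ
  open import Data.Integer.Tactic.RingSolver using (solve-∀)
  open import Relation.Binary.PropositionalEquality
  open import Defs using (b2ℤ)
  open Counting using (fromBool)

  +fromBool≡b2ℤ : ∀ c → + fromBool c ≡ b2ℤ c
  +fromBool≡b2ℤ true  = refl
  +fromBool≡b2ℤ false = refl

  dsrg-equation : ∀ {walks m l} c I → walks ℕ.+ fromBool c ℕ.* l ≡ m →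
                  + walks ≡ (+ m * I + (+ m - + l) * b2ℤ c) + + m * ((+ 1 - I) - b2ℤ c)
  dsrg-equation {walks} {m} {l} c I walks+cl≡m = begin
    + walks                                    ≡⟨ identity (+ walks) (+ l) (b2ℤ c) I ⟩
    rhs (+ walks + b2ℤ c * + l)                ≡⟨ cong rhs m≡ ⟨
    rhs (+ m)                                  ∎
    where
    open ≡-Reasoning
    rhs : ℤ → ℤ
    rhs M = (M * I + (M - + l) * b2ℤ c) + M * ((+ 1 - I) - b2ℤ c)
    identity : ∀ w l c I →
               w ≡ ((w + c * l) * I + ((w + c * l) - l) * c) + (w + c * l) * ((+ 1 - I) - c)
    identity = solve-∀
    m≡ : + m ≡ + walks + b2ℤ c * + l
    m≡ = begin
      + m                                ≡⟨ cong +_ walks+cl≡m ⟨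
      + (walks ℕ.+ fromBool c ℕ.* l)     ≡⟨ ℤ.pos-+ walks _ ⟩
      + walks + + (fromBool c ℕ.* l)     ≡⟨ cong (_+_ (+ walks)) (ℤ.pos-* (fromBool c) l) ⟩
      + walks + + fromBool c * + l       ≡⟨ cong (λ b → + walks + b * + l) (+fromBool≡b2ℤ c) ⟩
      + walks + b2ℤ c * + l              ∎

module DihedralDSRG (n : ℕ) .{{_ : NonZero n}} where

  open import Data.Nat as ℕ using (_+_; _*_; _∸_; _≡ᵇ_)
  import Data.Nat.Properties as ℕ
  import Data.Nat.Divisibility as ℕ
  open import Data.Nat.DivMod using (_%_; _/_; _mod_; m%n<n; m*n/n≡m)
  open import Data.Nat.Tactic.RingSolver using (solve-∀)
  open import Data.Bool using (Bool; true; false; _∧_)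
  open import Data.Bool.Properties using (⇔→≡; ¬-not; T-≡)
  open import Data.Fin using (Fin; toℕ)
  open import Data.Fin.Subset using (Subset; _∈_)
  open import Data.Vec using (lookup)
  open import Data.Vec.Properties using ([]=⇒lookup; lookup⇒[]=)
  open import Data.Product using (_×_; _,_; proj₁; proj₂; Σ)
  open import Data.Sum using (_⊎_; inj₁; inj₂; swap) renaming (map to map-⊎)
  open import Data.Integer using (+_; _-_)
  open import Function using (_∘_; _⇔_; mk⇔; Equivalence)
  import Function.Properties.Equivalence as ⇔
  open import Relation.Nullary using (¬_; contradiction)
  open import Relation.Binary.PropositionalEquality
  open import Defs using (InVZ; Dn; allDn; Dih; _≟D_; IsDSRG; count)
  open CyclicGroup n
  open Counting
  open DSRGEquation
  open Equivalence using (to; from)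

  -- The x-exponent of u⁻¹ x^j a^f, which does not depend on f.
  offset : Dn n → Fin n → Fin n
  offset (i , false) j = ⊝ i ⊕ j
  offset (i , true)  j = i ⊕ ⊝ j

  #-offset : ∀ u p → # (λ j → p (offset u j)) ≡ # p
  #-offset (i , false) = #-translate (⊝ i)
  #-offset (i , true)  = #-reflect i

  #-offset-source : ∀ f k p → # (λ j → p (offset (j , f) k)) ≡ # p
  #-offset-source false k p = trans (#-cong λ j → cong p (⊕-comm (⊝ j) k)) (#-reflect k p)
  #-offset-source true  k p = trans (#-cong λ j → cong p (⊕-comm j (⊝ k))) (#-translate (⊝ k) p)

  +vℤ-closed : ∀ {v} .{{_ : NonZero v}} → v ℕ.∣ n → (H X : Subset n) →
    ((i : Fin n) → (i ∈ X → Σ (Fin n) λ h → Σ (Fin n) λ w → h ∈ H × InVZ n v w × i ≡ h ⊕ w)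
                 × (Σ (Fin n) (λ h → Σ (Fin n) λ w → h ∈ H × InVZ n v w × i ≡ h ⊕ w) → i ∈ X)) →
    ∀ a w → InVZ n v w → a ∈ X → a ⊕ w ∈ X
  +vℤ-closed {v} v∣n H X X≡H+vℤ a w w∈vℤ a∈X with proj₁ (X≡H+vℤ a) a∈X
  ... | h , w₀ , h∈H , w₀∈vℤ , refl = proj₂ (X≡H+vℤ ((h ⊕ w₀) ⊕ w))
    (h , w₀ ⊕ w , h∈H , from (InVZ⇔∣ v∣n _) (∣-⊕ v∣n (in-vℤ w₀∈vℤ) (in-vℤ w∈vℤ)) , ⊕-assoc h w₀ w)
    where
    in-vℤ : ∀ {c} → InVZ n v c → v ℕ.∣ toℕ c
    in-vℤ = to (InVZ⇔∣ v∣n _)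

  module _ (v l : ℕ) .{{_ : NonZero v}} (n≡v*l : n ≡ v * l) (X : Subset n)
    (X+vℤ⊆X : ∀ a w → InVZ n v w → a ∈ X → a ⊕ w ∈ X)
    (X⊎-X : ∀ i → ((i ∈ X ⊎ ⊝ i ∈ X) → ¬ InVZ n v i) × (¬ InVZ n v i → (i ∈ X ⊎ ⊝ i ∈ X)))
    (X∩-X : ∀ i → ¬ (i ∈ X × ⊝ i ∈ X))
    where

    n≡l*v : n ≡ l * v
    n≡l*v = trans n≡v*l (ℕ.*-comm v l)

    v∣n : v ℕ.∣ n
    v∣n = ℕ.divides l n≡l*v

    x : Fin n → Bool
    x = lookup X

    x≡true⇒∈ : ∀ {a} → x a ≡ true → a ∈ X
    x≡true⇒∈ {a} = lookup⇒[]= a X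

    ∈⇒x≡true : ∀ {a} → a ∈ X → x a ≡ true
    ∈⇒x≡true = []=⇒lookup

    ∉⇒x≡false : ∀ {a} → ¬ a ∈ X → x a ≡ false
    ∉⇒x≡false a∉X = ¬-not (a∉X ∘ x≡true⇒∈)

    ∈-resp-% : ∀ {a b} → toℕ a % v ≡ toℕ b % v → a ∈ X → b ∈ X
    ∈-resp-% {a} {b} a≡b a∈X = subst (_∈ X) (⊕-cancelˡ a b) (X+vℤ⊆X a (⊝ a ⊕ b) ⊝a⊕b∈vℤ a∈X)
      where
      ⊝a⊕b∈vℤ : InVZ n v (⊝ a ⊕ b)
      ⊝a⊕b∈vℤ = from (InVZ⇔∣ v∣n _)
        (subst (λ c → v ℕ.∣ toℕ c) (⊕-comm b (⊝ a)) (from (∣⊕⊝⇔%≡ v∣n b a) (sym a≡b)))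

    x-resp-% : ∀ {a b} → toℕ a % v ≡ toℕ b % v → x a ≡ x b
    x-resp-% a≡b = ⇔→≡ (mk⇔ (∈⇒x≡true ∘ ∈-resp-% a≡b ∘ x≡true⇒∈)
                            (∈⇒x≡true ∘ ∈-resp-% (sym a≡b) ∘ x≡true⇒∈))

    sameClass : Fin n → Fin n → Bool
    sameClass j k = toℕ j % v ≡ᵇ toℕ k % v

    sameClass⇔%≡ : ∀ j k → sameClass j k ≡ true ⇔ toℕ j % v ≡ toℕ k % v
    sameClass⇔%≡ j k = mk⇔ (ℕ.≡ᵇ⇒≡ _ _ ∘ from T-≡) (to T-≡ ∘ ℕ.≡⇒≡ᵇ _ _)

    vℤ⇔sameClass : ∀ j k → InVZ n v (j ⊕ ⊝ k) ⇔ sameClass j k ≡ true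
    vℤ⇔sameClass j k =
      ⇔.trans (InVZ⇔∣ v∣n _) (⇔.trans (∣⊕⊝⇔%≡ v∣n j k) (⇔.sym (sameClass⇔%≡ j k)))

    #-sameClass : ∀ k → # (λ j → sameClass j k) ≡ l
    #-sameClass k = #-residue l v n≡l*v (m%n<n (toℕ k) v)

    offset-resp-% : ∀ u {j k} → toℕ j % v ≡ toℕ k % v → toℕ (offset u j) % v ≡ toℕ (offset u k) % v
    offset-resp-% (i , false) = %≡-⊕ v∣n (⊝ i)
    offset-resp-% (i , true)  = %≡-⊕ v∣n i ∘ %≡-⊝ v∣n

    trichotomy : ∀ j k →
                 fromBool (x (⊝ j ⊕ k)) + fromBool (x (j ⊕ ⊝ k)) + fromBool (sameClass j k) ≡ 1
    trichotomy j k =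
      subst (λ b → fromBool (x b) + fromBool (x a) + fromBool (sameClass j k) ≡ 1) (⊝-⊕-⊝ j k)
        (exactly-one (x (⊝ a)) (x a) (sameClass j k) same⇒neither ¬same⇒one not-both)
      where
      a = j ⊕ ⊝ k
      same⇒neither : sameClass j k ≡ true → x (⊝ a) ≡ false × x a ≡ false
      same⇒neither same = ∉⇒x≡false (neither ∘ inj₂) , ∉⇒x≡false (neither ∘ inj₁)
        where
        neither : ¬ (a ∈ X ⊎ ⊝ a ∈ X)
        neither a∈X⊎-X = proj₁ (X⊎-X a) a∈X⊎-X (from (vℤ⇔sameClass j k) same)
      ¬same⇒one : sameClass j k ≡ false → x (⊝ a) ≡ true ⊎ x a ≡ true
      ¬same⇒one ¬same = map-⊎ ∈⇒x≡true ∈⇒x≡true (swap (proj₂ (X⊎-X a) a∉vℤ))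
        where
        a∉vℤ : ¬ InVZ n v a
        a∉vℤ a∈vℤ = contradiction (trans (sym ¬same) (to (vℤ⇔sameClass j k) a∈vℤ)) λ ()
      not-both : ¬ (x (⊝ a) ≡ true × x a ≡ true)
      not-both (⊝a∈X , a∈X) = X∩-X a (x≡true⇒∈ a∈X , x≡true⇒∈ ⊝a∈X)

    #x+#x≡n∸l : # x + # x ≡ n ∸ l
    #x+#x≡n∸l = begin
      # x + # x             ≡⟨ ℕ.m+n∸n≡m (# x + # x) l ⟨
      # x + # x + l ∸ l     ≡⟨ cong (_∸ l) covering ⟩
      n ∸ l                 ∎
      where
      open ≡-Reasoning
      k : Fin n
      k = 0 mod n
      covering : # x + # x + l ≡ n
      covering = begin
        # x + # x + l
          ≡⟨ cong₂ _+_ (cong₂ _+_ (#-offset-source false k x) (#-offset-source true k x))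
                       (#-sameClass k) ⟨
        # (λ j → x (⊝ j ⊕ k)) + # (λ j → x (j ⊕ ⊝ k)) + # (λ j → sameClass j k)
          ≡⟨ #-partition _ _ _ _ (λ j → trichotomy j k) ⟩
        # (λ (_ : Fin n) → true)
          ≡⟨ #-true n ⟩
        n ∎

    half-n∸l≡#x : (n ∸ l) / 2 ≡ # x
    half-n∸l≡#x = begin
      (n ∸ l) / 2        ≡⟨ cong (_/ 2) #x+#x≡n∸l ⟨
      (# x + # x) / 2    ≡⟨ cong (_/ 2) (double (# x)) ⟩
      # x * 2 / 2        ≡⟨ m*n/n≡m (# x) 2 ⟩
      # x                ∎
      where
      open ≡-Reasoning
      double : ∀ m → m + m ≡ m * 2
      double = solve-∀

    arc-offset : ∀ u j f → Dih n X X u (j , f) ≡ x (offset u j)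
    arc-offset (i , false) j false = refl
    arc-offset (i , false) j true  = refl
    arc-offset (i , true)  j false = refl
    arc-offset (i , true)  j true  = refl

    out-degree : ∀ u → count (allDn n) (Dih n X X u) ≡ n ∸ l
    out-degree u = begin
      count (allDn n) (Dih n X X u)            ≡⟨ count-allDn n _ ⟩
      # (arcs false) + # (arcs true)           ≡⟨ cong₂ _+_ (#-arcs false) (#-arcs true) ⟩
      # x + # x                                ≡⟨ #x+#x≡n∸l ⟩
      n ∸ l                                    ∎
      where
      open ≡-Reasoning
      arcs : Bool → Fin n → Bool
      arcs f j = Dih n X X u (j , f)
      #-arcs : ∀ f → # (arcs f) ≡ # x
      #-arcs f = trans (#-cong λ j → arc-offset u j f) (#-offset u x)

    in-degree : ∀ w → count (allDn n) (λ z → Dih n X X z w) ≡ n ∸ l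
    in-degree (k , g) = begin
      count (allDn n) (λ z → Dih n X X z (k , g))  ≡⟨ count-allDn n _ ⟩
      # (arcs false) + # (arcs true)               ≡⟨ cong₂ _+_ (#-arcs false) (#-arcs true) ⟩
      # x + # x                                    ≡⟨ #x+#x≡n∸l ⟩
      n ∸ l                                        ∎
      where
      open ≡-Reasoning
      arcs : Bool → Fin n → Bool
      arcs f j = Dih n X X (j , f) (k , g)
      #-arcs : ∀ f → # (arcs f) ≡ # x
      #-arcs f = trans (#-cong λ j → arc-offset (j , f) k g) (#-offset-source f k x)

    walks-of-length-two : ∀ u w →
      count (allDn n) (λ z → Dih n X X u z ∧ Dih n X X z w) + fromBool (Dih n X X u w) * l ≡ # x
    walks-of-length-two u (k , g) = begin
      count (allDn n) (λ z → Dih n X X u z ∧ Dih n X X z (k , g)) + fromBool (Dih n X X u (k , g)) * l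
        ≡⟨ cong₂ (λ c b → c + fromBool b * l) walks-via-offsets (arc-offset u k g) ⟩
      # (λ j → P j ∧ x (⊝ j ⊕ k)) + # (λ j → P j ∧ x (j ⊕ ⊝ k)) + fromBool (P k) * l
        ≡⟨ cong₂ _+_ refl (cong (fromBool (P k) *_) (#-sameClass k)) ⟨
      # (λ j → P j ∧ x (⊝ j ⊕ k)) + # (λ j → P j ∧ x (j ⊕ ⊝ k)) + fromBool (P k) * # (λ j → sameClass j k)
        ≡⟨ #-∧-split P _ _ _ (P k) (λ j → trichotomy j k) P-constant-on-class ⟩
      # P
        ≡⟨ #-offset u x ⟩
      # x ∎
      where
      open ≡-Reasoning
      P : Fin n → Bool
      P j = x (offset u j)
      walks-via-offsets : count (allDn n) (λ z → Dih n X X u z ∧ Dih n X X z (k , g))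
                          ≡ # (λ j → P j ∧ x (⊝ j ⊕ k)) + # (λ j → P j ∧ x (j ⊕ ⊝ k))
      walks-via-offsets = trans (count-allDn n _) (cong₂ _+_ (#-cong (via false)) (#-cong (via true)))
        where
        via : ∀ f j → Dih n X X u (j , f) ∧ Dih n X X (j , f) (k , g) ≡ P j ∧ x (offset (j , f) k)
        via f j = cong₂ _∧_ (arc-offset u j f) (arc-offset (j , f) k g)
      P-constant-on-class : ∀ j → sameClass j k ≡ true → P j ≡ P k
      P-constant-on-class j same = x-resp-% (offset-resp-% u (to (sameClass⇔%≡ j k) same))

    isDSRG : IsDSRG (_≟D_ n) (allDn n) (Dih n X X)
               (2 * n) (n ∸ l) (+ ((n ∸ l) / 2)) (+ ((n ∸ l) / 2) - + l) (+ ((n ∸ l) / 2))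
    isDSRG = length-allDn n , out-degree , in-degree , λ u w →
      dsrg-equation (Dih n X X u w) _ (trans (walks-of-length-two u w) (sym half-n∸l≡#x))


open import Defs
open import Data.Nat using (ℕ; _*_; _∸_; _≤_; _<_; NonZero; >-nonZero)
open import Data.Nat.DivMod using (_/_; _%_)
open import Data.Nat.Divisibility using (_∣_; m∣m*n)
open import Data.Fin using (Fin; toℕ)
open import Data.Fin.Subset using (Subset; _∈_)
open import Data.Product using (_×_; Σ)
open import Data.Sum using (_⊎_)
open import Relation.Nullary using (¬_)
open import Relation.Binary.PropositionalEquality using (_≡_; sym; subst)
open import Data.Integer using (+_; _-_)

mainTheorem11 :
    (n : ℕ) .{{_ : NonZero n}} → 1 ≤ n →
    (v l : ℕ) → 1 ≤ v → v % 2 ≡ 1 → n ≡ v * l →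
    (H X : Subset n) →
    ((h : Fin n) → h ∈ H → (1 ≤ toℕ h × toℕ h < v)) →
    ((i : Fin n) → (i ∈ X → Σ (Fin n) λ h → Σ (Fin n) λ w →
                              h ∈ H × InVZ n v w × i ≡ _⊕_ n h w)
                 × (Σ (Fin n) (λ h → Σ (Fin n) λ w →
                              h ∈ H × InVZ n v w × i ≡ _⊕_ n h w) → i ∈ X)) →
    ((i : Fin n) → ((i ∈ X ⊎ (⊝_ n i) ∈ X) → ¬ InVZ n v i)
                 × (¬ InVZ n v i → (i ∈ X ⊎ (⊝_ n i) ∈ X))) →
    ((i : Fin n) → ¬ (i ∈ X × (⊝_ n i) ∈ X)) →
    IsDSRG (_≟D_ n) (allDn n) (Dih n X X)
      (2 * n) (n ∸ l) (+ ((n ∸ l) / 2)) (+ ((n ∸ l) / 2) - + l) (+ ((n ∸ l) / 2))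
mainTheorem11 n _ v l 1≤v _ n≡v*l H X _ X≡H+vℤ X⊎-X X∩-X =
  DihedralDSRG.isDSRG n v l n≡v*l X (DihedralDSRG.+vℤ-closed n v∣n H X X≡H+vℤ) X⊎-X X∩-X
  where
  instance
    v≢0 : NonZero v
    v≢0 = >-nonZero 1≤v
  v∣n : v ∣ n
  v∣n = subst (v ∣_) (sym n≡v*l) (m∣m*n l)
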